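{- Let $\sigma$ be an $\mathsf{rseq}$-substitution, let $\overline{w},\overline{y},\overline{x}\in\mathsf{rseq}$ and $\overline{z}\in\mathsf{seq}$ with $\overline{z}\overline{w}\rightsquigarrow\overline{x}$. Then for every bunch $X$, $\sigma^{\overline{x}}_{\overline{w}\mapsto\overline{y}}(X)=\sigma^{\mathsf{red}(\overline{z}\overline{y})}(X)$.
   Context: Atoms $\mathsf{At}$; formulas built by $\neg,\land,\lor,\to,\circ$; bunches built from formulas by comma $(X,Y)$ and semicolon $(X;Y)$. $\mathsf{seq}$ is the set of finite sequences over $\{l,r,\lambda,\rho,n\}$, juxtaposition = concatenation. One-step reduction $\rightsquigarrow'$ is generated by: $\overline{a}l\lambda\overline{b}\rightsquigarrow'\overline{a}\rho\overline{b}$; $\overline{a}r\lambda\overline{b}\rightsquigarrow'\overline{a}\overline{b}$; $\overline{a}\lambda r\overline{b}\rightsquigarrow'\overline{a}\overline{b}$; $\overline{a}\rho r\overline{b}\rightsquigarrow'\overline{a}l\overline{b}$; $\overline{a}nn\overline{b}\rightsquigarrow'\overline{a}\overline{b}$. $\mathsf{rseq}$ is the set of reduced sequences (no step applies); $\rightsquigarrow$ is the reflexive-transitive closure; $\mathsf{red}(\overline{a})$ is the unique reduced sequence $\overline{a}$ reduces to. An $\mathsf{rseq}$-substitution is $\sigma:\mathsf{rseq}\times\mathsf{At}\to$ formulas, written $\sigma^{\overline{a}}(p)$, extended to bunches by $\sigma^{\overline{a}}(A\land B)=\sigma^{\overline{a}}(A)\land\sigma^{\overline{a}}(B)$, $\sigma^{\overline{a}}(A\lor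 B)=\sigma^{\overline{a}}(A)\lor\sigma^{\overline{a}}(B)$, $\sigma^{\overline{a}}(\neg A)=\neg\sigma^{\mathsf{red}(n\overline{a})}(A)$, $\sigma^{\overline{a}}(A\to B)=\sigma^{\mathsf{red}(l\overline{a})}(A)\to\sigma^{\mathsf{red}(r\overline{a})}(B)$, $\sigma^{\overline{a}}(A\circ B)=\sigma^{\mathsf{red}(\lambda\overline{a})}(A)\circ\sigma^{\mathsf{red}(\rho\overline{a})}(B)$, $\sigma^{\overline{a}}(X,Y)=\sigma^{\overline{a}}(X),\sigma^{\overline{a}}(Y)$, $\sigma^{\overline{a}}(X;Y)=\sigma^{\mathsf{red}(\lambda\overline{a})}(X);\sigma^{\mathsf{red}(\rho\overline{a})}(Y)$. For $\overline{w},\overline{y}\in\mathsf{rseq}$, $\sigma_{\overline{w}\mapsto\overline{y}}$ is the $\mathsf{rseq}$-substitution given on atoms by $\sigma^{\overline{a}}_{\overline{w}\mapsto\overline{y}}(p)=\sigma^{\mathsf{red}(\overline{b}\overline{y})}(p)$ if $\overline{b}\overline{w}\rightsquigarrow\overline{a}$ for some $\overline{b}\in\mathsf{seq}$ (this value does not depend on $\overline{b}$), and $\sigma^{\overline{a}}(p)$ otherwise; it is extended to bunches by the same clauses. -}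

module Defs where

open import Data.Nat using (ℕ; zero; suc)
open import Data.List using (List; []; _∷_; _++_; length)
open import Data.Maybe using (Maybe; just; nothing)
open import Data.Product using (∃; _,_)
open import Relation.Nullary using (¬_; Dec; yes; no)
open import Relation.Binary.Construct.Closure.ReflexiveTransitive using (Star)

data Letter : Set where
  l r lam rho n : Letter

Seq : Set
Seq = List Letter

data _⇝₁_ : Seq → Seq → Set where
  lλ : ∀ a b → (a ++ l ∷ lam ∷ b) ⇝₁ (a ++ rho ∷ b)
  rλ : ∀ a b → (a ++ r ∷ lam ∷ b) ⇝₁ (a ++ b)
  λr : ∀ a b → (a ++ lam ∷ r ∷ b) ⇝₁ (a ++ b)
  ρr : ∀ a b → (a ++ rho ∷ r ∷ b) ⇝₁ (a ++ l ∷ b)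
  nn : ∀ a b → (a ++ n ∷ n ∷ b) ⇝₁ (a ++ b)

_⇝_ : Seq → Seq → Set
_⇝_ = Star _⇝₁_

Reduced : Seq → Set
Reduced a = ∀ b → ¬ (a ⇝₁ b)

-- red: reduce (leftmost redex first) until no step applies.
-- Each step shortens the sequence, so length a steps suffice.
step : Seq → Maybe Seq
step (l ∷ lam ∷ b) = just (rho ∷ b)
step (r ∷ lam ∷ b) = just b
step (lam ∷ r ∷ b) = just b
step (rho ∷ r ∷ b) = just (l ∷ b)
step (n ∷ n ∷ b) = just b
step [] = nothing
step (x ∷ b) with step b
... | just b' = just (x ∷ b')
... | nothing = nothing

iter : ℕ → Seq → Seq
iter zero a = a
iter (suc k) a with step a
... | just a' = iter k a'
... | nothing = a

red : Seq → Seq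
red a = iter (length a) a

data Formula (At : Set) : Set where
  atom : At → Formula At
  ¬'_ : Formula At → Formula At
  _∧'_ _∨'_ _⇒_ _∘'_ : Formula At → Formula At → Formula At

data Bunch (At : Set) : Set where
  fm : Formula At → Bunch At
  _,,_ : Bunch At → Bunch At → Bunch At
  _⨾_ : Bunch At → Bunch At → Bunch At

-- an rseq-substitution: σ a p = σ^a(p); only values at reduced a matter
Subst : Set → Set
Subst At = Seq → At → Formula At

substF : {At : Set} → Subst At → Seq → Formula At → Formula At
substF σ a (atom p) = σ a p
substF σ a (¬' A) = ¬' substF σ (red (n ∷ a)) A
substF σ a (A ∧' B) = substF σ a A ∧' substF σ a B
substF σ a (A ∨' B) = substF σ a A ∨' substF σ a B
substF σ a (A ⇒ B) = substF σ (red (l ∷ a)) A ⇒ substF σ (red (r ∷ a)) B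
substF σ a (A ∘' B) = substF σ (red (lam ∷ a)) A ∘' substF σ (red (rho ∷ a)) B

substB : {At : Set} → Subst At → Seq → Bunch At → Bunch At
substB σ a (fm A) = fm (substF σ a A)
substB σ a (X ,, Y) = substB σ a X ,, substB σ a Y
substB σ a (X ⨾ Y) = substB σ (red (lam ∷ a)) X ⨾ substB σ (red (rho ∷ a)) Y

Reach : Seq → Seq → Set
Reach w a = ∃ λ b → (b ++ w) ⇝ a

-- σ_{w ↦ y}; the case distinction is made via a decision procedure dec
-- for the (classical) condition; the witness b is the one provided by dec.
shift : {At : Set} → Subst At → (w y : Seq) → (∀ a → Dec (Reach w a)) → Subst At
shift σ w y dec a p with dec a
... | yes (b , _) = σ (red (b ++ y)) p
... | no _ = σ a p

-- Reading a word letter by letter onto a stack that is kept reduced turns each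
-- rewrite rule into an identity between stack operations, so the final stack is
-- invariant under ⇝; as red a is irreducible, red a is the reversed stack of a.
-- Pushing a letter is injective on reduced stacks, so if b w and z w both reduce
-- to x then b and z leave the same stack, whence red (b y) = red (z y): at x the
-- substitution σ_{w↦y} is σ at red (z y), whatever witness b was chosen.
-- From z w ⇝ x follows (c z) w ⇝ red (c x), and red (c z y) = red (c red (z y)),
-- which carries the statement through every connective.

module Submission where

open import Defs
open import Data.Bool using (Bool; true; false; not; T)
open import Data.Empty using (⊥-elim)
open import Data.List using ([]; _∷_; _++_; length; foldl; reverse; _ʳ++_)
open import Data.List.Properties using (foldl-++; reverse-involutive)
open import Data.List.Relation.Unary.Linked using (Linked; []; [-]; _∷_; tail)
open import Data.Maybe using (Maybe; just; nothing)
open import Data.Nat using (_≤_; _<_; zero; suc; s≤s)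
open import Data.Nat.Properties using (≤-refl; n≤1+n; <-≤-trans; ≤-pred)
open import Data.Product using (∃; _×_; _,_; proj₁; proj₂; map₁)
open import Function using (flip)
open import Relation.Nullary using (Dec; yes; no)
open import Relation.Binary.PropositionalEquality using (_≡_; refl; sym; trans; cong; cong₂; module ≡-Reasoning)
open import Relation.Binary.Construct.Closure.ReflexiveTransitive using (ε; _◅_; _◅◅_; gmap)

-- Split on the second letter first, so that redex x l and redex x rho compute.
redex : Letter → Letter → Bool
redex _   l   = false
redex _   rho = false
redex l   lam = true
redex r   lam = true
redex _   lam = false
redex lam r   = true
redex rho r   = true
redex _   r   = false
redex n   n   = true
redex _   n   = false

NoRedex : Letter → Letter → Set
NoRedex x y = T (not (redex x y))

Irreducible : Seq → Set
Irreducible = Linked NoRedex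

-- A reduced word stored in reverse: the head is the last letter.
Stack : Set
Stack = Seq

ReducedStack : Stack → Set
ReducedStack = Linked (flip NoRedex)

push : Stack → Letter → Stack
push S         l   = l ∷ S
push S         rho = rho ∷ S
push (l ∷ S)   lam = rho ∷ S
push (r ∷ S)   lam = S
push S         lam = lam ∷ S
push (lam ∷ S) r   = S
push (rho ∷ S) r   = l ∷ S
push S         r   = r ∷ S
push (n ∷ S)   n   = S
push S         n   = n ∷ S

push-reduced : ∀ S x → ReducedStack S → ReducedStack (push S x)
push-reduced []          l   _       = [-]
push-reduced (_ ∷ _)     l   p       = _ ∷ p
push-reduced []          rho _       = [-]
push-reduced (_ ∷ _)     rho p       = _ ∷ p
push-reduced []          lam _       = [-]
push-reduced (l ∷ [])    lam _       = [-]
push-reduced (l ∷ _ ∷ _) lam (_ ∷ p) = _ ∷ p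
push-reduced (r ∷ _)     lam p       = tail p
push-reduced (lam ∷ _)   lam p       = _ ∷ p
push-reduced (rho ∷ _)   lam p       = _ ∷ p
push-reduced (n ∷ _)     lam p       = _ ∷ p
push-reduced []            r _       = [-]
push-reduced (l ∷ _)       r p       = _ ∷ p
push-reduced (r ∷ _)       r p       = _ ∷ p
push-reduced (lam ∷ _)     r p       = tail p
push-reduced (rho ∷ [])    r _       = [-]
push-reduced (rho ∷ _ ∷ _) r (_ ∷ p) = _ ∷ p
push-reduced (n ∷ _)       r p       = _ ∷ p
push-reduced []        n _ = [-]
push-reduced (l ∷ _)   n p = _ ∷ p
push-reduced (r ∷ _)   n p = _ ∷ p
push-reduced (lam ∷ _) n p = _ ∷ p
push-reduced (rho ∷ _) n p = _ ∷ p
push-reduced (n ∷ _)   n p = tail p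

push-∷ : ∀ S x → ReducedStack (x ∷ S) → push S x ≡ x ∷ S
push-∷ S         l   _ = refl
push-∷ S         rho _ = refl
push-∷ []        lam _ = refl
push-∷ (l ∷ _)   lam (() ∷ _)
push-∷ (r ∷ _)   lam (() ∷ _)
push-∷ (lam ∷ _) lam _ = refl
push-∷ (rho ∷ _) lam _ = refl
push-∷ (n ∷ _)   lam _ = refl
push-∷ []        r   _ = refl
push-∷ (l ∷ _)   r   _ = refl
push-∷ (r ∷ _)   r   _ = refl
push-∷ (lam ∷ _) r   (() ∷ _)
push-∷ (rho ∷ _) r   (() ∷ _)
push-∷ (n ∷ _)   r   _ = refl
push-∷ []        n   _ = refl
push-∷ (l ∷ _)   n   _ = refl
push-∷ (r ∷ _)   n   _ = refl
push-∷ (lam ∷ _) n   _ = refl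
push-∷ (rho ∷ _) n   _ = refl
push-∷ (n ∷ _)   n   (() ∷ _)

push-rλ : ∀ S → ReducedStack S → push (push S r) lam ≡ S
push-rλ []              _ = refl
push-rλ (l ∷ _)         _ = refl
push-rλ (r ∷ _)         _ = refl
push-rλ (lam ∷ [])      _ = refl
push-rλ (lam ∷ l ∷ _)   (() ∷ _)
push-rλ (lam ∷ r ∷ _)   (() ∷ _)
push-rλ (lam ∷ lam ∷ _) _ = refl
push-rλ (lam ∷ rho ∷ _) _ = refl
push-rλ (lam ∷ n ∷ _)   _ = refl
push-rλ (rho ∷ _)       _ = refl
push-rλ (n ∷ _)         _ = refl

push-λr : ∀ S → ReducedStack S → push (push S lam) r ≡ S
push-λr []            _ = refl
push-λr (l ∷ _)       _ = refl
push-λr (r ∷ [])      _ = refl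
push-λr (r ∷ l ∷ _)   _ = refl
push-λr (r ∷ r ∷ _)   _ = refl
push-λr (r ∷ lam ∷ _) (() ∷ _)
push-λr (r ∷ rho ∷ _) (() ∷ _)
push-λr (r ∷ n ∷ _)   _ = refl
push-λr (lam ∷ _)     _ = refl
push-λr (rho ∷ _)     _ = refl
push-λr (n ∷ _)       _ = refl

push-nn : ∀ S → ReducedStack S → push (push S n) n ≡ S
push-nn []            _ = refl
push-nn (l ∷ _)       _ = refl
push-nn (r ∷ _)       _ = refl
push-nn (lam ∷ _)     _ = refl
push-nn (rho ∷ _)     _ = refl
push-nn (n ∷ [])      _ = refl
push-nn (n ∷ l ∷ _)   _ = refl
push-nn (n ∷ r ∷ _)   _ = refl
push-nn (n ∷ lam ∷ _) _ = refl
push-nn (n ∷ rho ∷ _) _ = refl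
push-nn (n ∷ n ∷ _)   (() ∷ _)

unpush : Stack → Letter → Stack
unpush (l ∷ S)   l   = S
unpush (rho ∷ S) rho = S
unpush (rho ∷ S) lam = l ∷ S
unpush (lam ∷ S) lam = S
unpush S         lam = r ∷ S
unpush (l ∷ S)   r   = rho ∷ S
unpush (r ∷ S)   r   = S
unpush S         r   = lam ∷ S
unpush (n ∷ S)   n   = S
unpush S         n   = n ∷ S
unpush S         _   = S

unpush-push : ∀ S x → ReducedStack S → unpush (push S x) x ≡ S
unpush-push S             l   _ = refl
unpush-push S             rho _ = refl
unpush-push []            lam _ = refl
unpush-push (l ∷ _)       lam _ = refl
unpush-push (r ∷ [])      lam _ = refl
unpush-push (r ∷ l ∷ _)   lam _ = refl
unpush-push (r ∷ r ∷ _)   lam _ = refl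
unpush-push (r ∷ lam ∷ _) lam (() ∷ _)
unpush-push (r ∷ rho ∷ _) lam (() ∷ _)
unpush-push (r ∷ n ∷ _)   lam _ = refl
unpush-push (lam ∷ _)     lam _ = refl
unpush-push (rho ∷ _)     lam _ = refl
unpush-push (n ∷ _)       lam _ = refl
unpush-push []              r _ = refl
unpush-push (l ∷ _)         r _ = refl
unpush-push (r ∷ _)         r _ = refl
unpush-push (lam ∷ [])      r _ = refl
unpush-push (lam ∷ l ∷ _)   r (() ∷ _)
unpush-push (lam ∷ r ∷ _)   r (() ∷ _)
unpush-push (lam ∷ lam ∷ _) r _ = refl
unpush-push (lam ∷ rho ∷ _) r _ = refl
unpush-push (lam ∷ n ∷ _)   r _ = refl
unpush-push (rho ∷ _)       r _ = refl
unpush-push (n ∷ _)         r _ = refl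
unpush-push []            n _ = refl
unpush-push (l ∷ _)       n _ = refl
unpush-push (r ∷ _)       n _ = refl
unpush-push (lam ∷ _)     n _ = refl
unpush-push (rho ∷ _)     n _ = refl
unpush-push (n ∷ [])      n _ = refl
unpush-push (n ∷ l ∷ _)   n _ = refl
unpush-push (n ∷ r ∷ _)   n _ = refl
unpush-push (n ∷ lam ∷ _) n _ = refl
unpush-push (n ∷ rho ∷ _) n _ = refl
unpush-push (n ∷ n ∷ _)   n (() ∷ _)

eval : Stack → Seq → Stack
eval = foldl push

eval-reduced : ∀ S a → ReducedStack S → ReducedStack (eval S a)
eval-reduced S []      p = p
eval-reduced S (x ∷ a) p = eval-reduced (push S x) a (push-reduced S x p)

eval-cancelʳ : ∀ w {S T} → ReducedStack S → ReducedStack T → eval S w ≡ eval T w → S ≡ T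
eval-cancelʳ []      _ _ e = e
eval-cancelʳ (x ∷ w) {S} {T} p q e = begin
  S                     ≡⟨ unpush-push S x p ⟨
  unpush (push S x) x   ≡⟨ cong (λ U → unpush U x) push-eq ⟩
  unpush (push T x) x   ≡⟨ unpush-push T x q ⟩
  T                     ∎
  where
  open ≡-Reasoning
  push-eq : push S x ≡ push T x
  push-eq = eval-cancelʳ w (push-reduced S x p) (push-reduced T x q) e

eval-irreducible : ∀ S x c → ReducedStack (x ∷ S) → Irreducible (x ∷ c) → eval S (x ∷ c) ≡ c ʳ++ (x ∷ S)
eval-irreducible S x [] p _ = push-∷ S x p
eval-irreducible S x (y ∷ c) p (xy ∷ i) = begin
  eval (push S x) (y ∷ c)  ≡⟨ cong (λ U → eval U (y ∷ c)) (push-∷ S x p) ⟩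
  eval (x ∷ S) (y ∷ c)     ≡⟨ eval-irreducible (x ∷ S) y c (xy ∷ p) i ⟩
  c ʳ++ (y ∷ x ∷ S)        ∎
  where open ≡-Reasoning

eval-reverse : ∀ c → Irreducible c → eval [] c ≡ reverse c
eval-reverse []      _ = refl
eval-reverse (x ∷ c) i = eval-irreducible [] x c [-] i

_≈_ : Seq → Seq → Set
a ≈ b = eval [] a ≡ eval [] b

≈-infix : ∀ a {u v} → (∀ {S} → ReducedStack S → eval S u ≡ eval S v) → (a ++ u) ≈ (a ++ v)
≈-infix a {u} {v} e = begin
  eval [] (a ++ u)     ≡⟨ foldl-++ push [] a u ⟩
  eval (eval [] a) u   ≡⟨ e (eval-reduced [] a []) ⟩
  eval (eval [] a) v   ≡⟨ foldl-++ push [] a v ⟨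
  eval [] (a ++ v)     ∎
  where open ≡-Reasoning

⇝₁⇒≈ : ∀ {a b} → a ⇝₁ b → a ≈ b
⇝₁⇒≈ (lλ a b) = ≈-infix a (λ _ → refl)
⇝₁⇒≈ (rλ a b) = ≈-infix a (λ {S} p → cong (λ U → eval U b) (push-rλ S p))
⇝₁⇒≈ (λr a b) = ≈-infix a (λ {S} p → cong (λ U → eval U b) (push-λr S p))
⇝₁⇒≈ (ρr a b) = ≈-infix a (λ _ → refl)
⇝₁⇒≈ (nn a b) = ≈-infix a (λ {S} p → cong (λ U → eval U b) (push-nn S p))

⇝⇒≈ : ∀ {a b} → a ⇝ b → a ≈ b
⇝⇒≈ ε        = refl
⇝⇒≈ (s ◅ ss) = trans (⇝₁⇒≈ s) (⇝⇒≈ ss)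

≈-cancelʳ : ∀ b z w → (b ++ w) ≈ (z ++ w) → b ≈ z
≈-cancelʳ b z w e = eval-cancelʳ w (eval-reduced [] b []) (eval-reduced [] z [])
  (trans (sym (foldl-++ push [] b w)) (trans e (foldl-++ push [] z w)))

≈-congʳ : ∀ b z y → b ≈ z → (b ++ y) ≈ (z ++ y)
≈-congʳ b z y e = begin
  eval [] (b ++ y)     ≡⟨ foldl-++ push [] b y ⟩
  eval (eval [] b) y   ≡⟨ cong (λ U → eval U y) e ⟩
  eval (eval [] z) y   ≡⟨ foldl-++ push [] z y ⟨
  eval [] (z ++ y)     ∎
  where open ≡-Reasoning

∷-⇝₁ : ∀ x {a b} → a ⇝₁ b → (x ∷ a) ⇝₁ (x ∷ b)
∷-⇝₁ x (lλ a b) = lλ (x ∷ a) b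
∷-⇝₁ x (rλ a b) = rλ (x ∷ a) b
∷-⇝₁ x (λr a b) = λr (x ∷ a) b
∷-⇝₁ x (ρr a b) = ρr (x ∷ a) b
∷-⇝₁ x (nn a b) = nn (x ∷ a) b

∷-⇝ : ∀ x {a b} → a ⇝ b → (x ∷ a) ⇝ (x ∷ b)
∷-⇝ x = gmap (x ∷_) (∷-⇝₁ x)

StepSpec : Seq → Maybe Seq → Set
StepSpec a (just b) = a ⇝₁ b × length b < length a
StepSpec a nothing  = Irreducible a

-- step only reaches its recursive clause once both leading letters are known, so
-- the twenty non-redex pairs are listed one by one.
step-spec : ∀ a → StepSpec a (step a)
step-spec []          = []
step-spec (l ∷ [])    = [-]
step-spec (r ∷ [])    = [-]
step-spec (lam ∷ [])  = [-]
step-spec (rho ∷ [])  = [-]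
step-spec (n ∷ [])    = [-]
step-spec (l ∷ lam ∷ b) = lλ [] b , ≤-refl
step-spec (r ∷ lam ∷ b) = rλ [] b , n≤1+n _
step-spec (lam ∷ r ∷ b) = λr [] b , n≤1+n _
step-spec (rho ∷ r ∷ b) = ρr [] b , ≤-refl
step-spec (n ∷ n ∷ b)   = nn [] b , n≤1+n _
step-spec (l ∷ l ∷ b) with step (l ∷ b) | step-spec (l ∷ b)
... | just _  | s , lt = ∷-⇝₁ l s , s≤s lt
... | nothing | i      = _ ∷ i
step-spec (l ∷ r ∷ b) with step (r ∷ b) | step-spec (r ∷ b)
... | just _  | s , lt = ∷-⇝₁ l s , s≤s lt
... | nothing | i      = _ ∷ i
step-spec (l ∷ rho ∷ b) with step (rho ∷ b) | step-spec (rho ∷ b)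
... | just _  | s , lt = ∷-⇝₁ l s , s≤s lt
... | nothing | i      = _ ∷ i
step-spec (l ∷ n ∷ b) with step (n ∷ b) | step-spec (n ∷ b)
... | just _  | s , lt = ∷-⇝₁ l s , s≤s lt
... | nothing | i      = _ ∷ i
step-spec (r ∷ l ∷ b) with step (l ∷ b) | step-spec (l ∷ b)
... | just _  | s , lt = ∷-⇝₁ r s , s≤s lt
... | nothing | i      = _ ∷ i
step-spec (r ∷ r ∷ b) with step (r ∷ b) | step-spec (r ∷ b)
... | just _  | s , lt = ∷-⇝₁ r s , s≤s lt
... | nothing | i      = _ ∷ i
step-spec (r ∷ rho ∷ b) with step (rho ∷ b) | step-spec (rho ∷ b)
... | just _  | s , lt = ∷-⇝₁ r s , s≤s lt
... | nothing | i      = _ ∷ i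
step-spec (r ∷ n ∷ b) with step (n ∷ b) | step-spec (n ∷ b)
... | just _  | s , lt = ∷-⇝₁ r s , s≤s lt
... | nothing | i      = _ ∷ i
step-spec (lam ∷ l ∷ b) with step (l ∷ b) | step-spec (l ∷ b)
... | just _  | s , lt = ∷-⇝₁ lam s , s≤s lt
... | nothing | i      = _ ∷ i
step-spec (lam ∷ lam ∷ b) with step (lam ∷ b) | step-spec (lam ∷ b)
... | just _  | s , lt = ∷-⇝₁ lam s , s≤s lt
... | nothing | i      = _ ∷ i
step-spec (lam ∷ rho ∷ b) with step (rho ∷ b) | step-spec (rho ∷ b)
... | just _  | s , lt = ∷-⇝₁ lam s , s≤s lt
... | nothing | i      = _ ∷ i
step-spec (lam ∷ n ∷ b) with step (n ∷ b) | step-spec (n ∷ b)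
... | just _  | s , lt = ∷-⇝₁ lam s , s≤s lt
... | nothing | i      = _ ∷ i
step-spec (rho ∷ l ∷ b) with step (l ∷ b) | step-spec (l ∷ b)
... | just _  | s , lt = ∷-⇝₁ rho s , s≤s lt
... | nothing | i      = _ ∷ i
step-spec (rho ∷ lam ∷ b) with step (lam ∷ b) | step-spec (lam ∷ b)
... | just _  | s , lt = ∷-⇝₁ rho s , s≤s lt
... | nothing | i      = _ ∷ i
step-spec (rho ∷ rho ∷ b) with step (rho ∷ b) | step-spec (rho ∷ b)
... | just _  | s , lt = ∷-⇝₁ rho s , s≤s lt
... | nothing | i      = _ ∷ i
step-spec (rho ∷ n ∷ b) with step (n ∷ b) | step-spec (n ∷ b)
... | just _  | s , lt = ∷-⇝₁ rho s , s≤s lt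
... | nothing | i      = _ ∷ i
step-spec (n ∷ l ∷ b) with step (l ∷ b) | step-spec (l ∷ b)
... | just _  | s , lt = ∷-⇝₁ n s , s≤s lt
... | nothing | i      = _ ∷ i
step-spec (n ∷ r ∷ b) with step (r ∷ b) | step-spec (r ∷ b)
... | just _  | s , lt = ∷-⇝₁ n s , s≤s lt
... | nothing | i      = _ ∷ i
step-spec (n ∷ lam ∷ b) with step (lam ∷ b) | step-spec (lam ∷ b)
... | just _  | s , lt = ∷-⇝₁ n s , s≤s lt
... | nothing | i      = _ ∷ i
step-spec (n ∷ rho ∷ b) with step (rho ∷ b) | step-spec (rho ∷ b)
... | just _  | s , lt = ∷-⇝₁ n s , s≤s lt
... | nothing | i      = _ ∷ i

iter-spec : ∀ k a → length a ≤ k → (a ⇝ iter k a) × Irreducible (iter k a)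
iter-spec zero [] _ = ε , []
iter-spec (suc k) a le with step a | step-spec a
... | just b  | s , lt = map₁ (s ◅_) (iter-spec k b (≤-pred (<-≤-trans lt le)))
... | nothing | i      = ε , i

red-⇝ : ∀ a → a ⇝ red a
red-⇝ a = proj₁ (iter-spec (length a) a ≤-refl)

red-irreducible : ∀ a → Irreducible (red a)
red-irreducible a = proj₂ (iter-spec (length a) a ≤-refl)

red-eval : ∀ a → red a ≡ reverse (eval [] a)
red-eval a = begin
  red a                          ≡⟨ reverse-involutive (red a) ⟨
  reverse (reverse (red a))      ≡⟨ cong reverse (eval-reverse (red a) (red-irreducible a)) ⟨
  reverse (eval [] (red a))      ≡⟨ cong reverse (⇝⇒≈ (red-⇝ a)) ⟨
  reverse (eval [] a)            ∎
  where open ≡-Reasoning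

red-cong : ∀ {a b} → a ≈ b → red a ≡ red b
red-cong {a} {b} e = trans (red-eval a) (trans (cong reverse e) (sym (red-eval b)))

red-∷-red : ∀ x a → red (x ∷ red a) ≡ red (x ∷ a)
red-∷-red x a = red-cong {x ∷ red a} {x ∷ a} (sym (⇝⇒≈ (∷-⇝ x (red-⇝ a))))

red-++-irrelevant : ∀ b z w y {x} → (b ++ w) ⇝ x → (z ++ w) ⇝ x → red (b ++ y) ≡ red (z ++ y)
red-++-irrelevant b z w y s s′ =
  red-cong {b ++ y} {z ++ y} (≈-congʳ b z y (≈-cancelʳ b z w (trans (⇝⇒≈ s) (sym (⇝⇒≈ s′)))))

∷-⇝-red : ∀ x {a b} → a ⇝ b → (x ∷ a) ⇝ red (x ∷ b)
∷-⇝-red x {b = b} s = ∷-⇝ x s ◅◅ red-⇝ (x ∷ b)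

module _ {At : Set} (σ : Subst At) (w y : Seq) (dec : ∀ a → Dec (Reach w a)) where

  _↦_ : Seq → Seq → Set
  x ↦ a = ∃ λ z → (z ++ w) ⇝ x × red (z ++ y) ≡ a

  ↦-∷ : ∀ c {x a} → x ↦ a → red (c ∷ x) ↦ red (c ∷ a)
  ↦-∷ c (z , s , refl) = c ∷ z , ∷-⇝-red c s , sym (red-∷-red c (z ++ y))

  shift-↦ : ∀ {x a} → x ↦ a → ∀ p → shift σ w y dec x p ≡ σ a p
  shift-↦ {x} (z , s , refl) p with dec x
  ... | yes (b , s′) = cong (λ a → σ a p) (red-++-irrelevant b z w y s′ s)
  ... | no ¬reach    = ⊥-elim (¬reach (z , s))

  substF-↦ : ∀ A {x a} → x ↦ a → substF (shift σ w y dec) x A ≡ substF σ a A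
  substF-↦ (atom p) m = shift-↦ m p
  substF-↦ (¬' A)   m = cong ¬'_ (substF-↦ A (↦-∷ n m))
  substF-↦ (A ∧' B) m = cong₂ _∧'_ (substF-↦ A m) (substF-↦ B m)
  substF-↦ (A ∨' B) m = cong₂ _∨'_ (substF-↦ A m) (substF-↦ B m)
  substF-↦ (A ⇒ B)  m = cong₂ _⇒_ (substF-↦ A (↦-∷ l m)) (substF-↦ B (↦-∷ r m))
  substF-↦ (A ∘' B) m = cong₂ _∘'_ (substF-↦ A (↦-∷ lam m)) (substF-↦ B (↦-∷ rho m))

  substB-↦ : ∀ X {x a} → x ↦ a → substB (shift σ w y dec) x X ≡ substB σ a X
  substB-↦ (fm A)   m = cong fm (substF-↦ A m)
  substB-↦ (X ,, Y) m = cong₂ _,,_ (substB-↦ X m) (substB-↦ Y m)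
  substB-↦ (X ⨾ Y)  m = cong₂ _⨾_ (substB-↦ X (↦-∷ lam m)) (substB-↦ Y (↦-∷ rho m))

lemma34 : {At : Set} (σ : Subst At) (w y x z : Seq) →
    Reduced w → Reduced y → Reduced x → (z ++ w) ⇝ x →
    (dec : ∀ a → Dec (Reach w a)) →
    (X : Bunch At) → substB (shift σ w y dec) x X ≡ substB σ (red (z ++ y)) X
lemma34 σ w y x z _ _ _ s dec X = substB-↦ σ w y dec X (z , s , refl)
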